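{- Let $\mathcal{I},\mathcal{J}$ be $S5$-interpretations, $(w,d)\in W^\mathcal{I}\times\Delta^\mathcal{I}$, $(v,e)\in W^\mathcal{J}\times\Delta^\mathcal{J}$, and $n\ge0$. Then: (1) if $\mathcal{I},w,d\approx_{2n+1}\mathcal{J},v,e$, then $\mathcal{I},w,d\approx^{\mathsf{alt}}_n\mathcal{J},v,e$; (2) if $\mathcal{I},w,d\approx^{\mathsf{alt}}_n\mathcal{J},v,e$, then $\mathcal{I},w,d\approx_n\mathcal{J},v,e$; (3) $\mathcal{I},w,d\approx\mathcal{J},v,e$ iff $\mathcal{I},w,d\approx^{\mathsf{alt}}\mathcal{J},v,e$.
   Context: Fix sets $\mathsf{N}_\mathsf{C}$ of concept names and $\mathsf{N}_\mathsf{R}$ of role names. An $S5$-interpretation $\mathcal{I}$ consists of nonempty sets $W^\mathcal{I}$ (worlds), $\Delta^\mathcal{I}$ (individuals) and, for each $w\in W^\mathcal{I}$, sets $A^{\mathcal{I},w}\subseteq\Delta^\mathcal{I}$ ($A\in\mathsf{N}_\mathsf{C}$) and relations $r^{\mathcal{I},w}\subseteq\Delta^\mathcal{I}\times\Delta^\mathcal{I}$ ($r\in\mathsf{N}_\mathsf{R}$). Bisimulation game for $\mathcal{I},w_0,d_0$ and $\mathcal{J},v_0,e_0$: players $S$ (Spoiler) and $D$ (Duplicator); configurations are pairs $((w,d),(v,e))\in(W^\mathcal{I}\times\Delta^\mathcal{I})\times(W^\mathcal{J}\times\Delta^\mathcal{J})$, initially $((w_0,d_0),(v_0,e_0))$.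 A round is a move by $S$ followed by a move by $D$, from configuration $((w,d),(v,e))$: ($W$-moves) $S$ picks $w'\in W^\mathcal{I}$ and $D$ picks $v'\in W^\mathcal{J}$, new configuration $((w',d),(v',e))$, or symmetrically $S$ picks in $W^\mathcal{J}$ and $D$ in $W^\mathcal{I}$; ($\Delta$-moves) $S$ picks $r\in\mathsf{N}_\mathsf{R}$ and $d'$ with $(d,d')\in r^{\mathcal{I},w}$, $D$ picks $e'$ with $(e,e')\in r^{\mathcal{J},v}$, new configuration $((w,d'),(v,e'))$, or symmetrically with $\mathcal{I},\mathcal{J}$ swapped. A player who cannot move loses. A configuration is winning for $S$ if some $A\in\mathsf{N}_\mathsf{C}$ has $d\in A^{\mathcal{I},w}$ but $e\notin A^{\mathcal{J},v}$ or vice versa; $S$ wins when such a configuration is reached; infinite plays avoiding them are won by $D$. $\mathcal{I},w_0,d_0\approx\mathcal{J},v_0,e_0$ iff $D$ has a winning strategy. In the $n$-round game at most $n$ rounds are played and $D$ wins if no winning configuration for $S$ has been reached after $n$ rounds; $\approx_n$ means $D$ has a winning strategy in it. Alternating bisimulation game: same, but each round has two phases: (i) $S$ may choose to make a $W$-move, in which case $D$ responds with a $W$-move; then (ii) $S$ and $D$ each make exactly one $\Delta$-move. $D$ must avoid winning configurations for $S$ at all times. In the $n$-round alternating game, at most $n$ rounds are played, followed possibly by one extra phase of type (i). $\approx^{\mathsf{alt}}$ and $\approx^{\mathsf{alt}}_n$ mean $D$ has a winning strategy in the unbounded, respectively $n$-round, alternating game. -}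

module Defs where

open import Data.Nat using (ℕ; zero; suc)
open import Data.Product using (Σ; _×_; _,_; ∃-syntax)

-- S5-interpretation over concept names NC and role names NR.
-- Nonemptiness of W and Δ is witnessed by distinguished elements.
record S5Interp (NC NR : Set) : Set₁ where
  field
    W    : Set
    Δ    : Set
    someW : W
    someΔ : Δ
    conc : NC → W → Δ → Set
    role : NR → W → Δ → Δ → Set

open S5Interp public

module Game {NC NR : Set} (I J : S5Interp NC NR) where

  record Conf : Set where
    constructor conf
    field
      wI : W I
      dI : Δ I
      vJ : W J
      eJ : Δ J
  open Conf public

  -- not a winning configuration for S: same concept names on both sides
  Good : Conf → Set
  Good (conf w d v e) =
    (A : NC) → (conc I A w d → conc J A v e) × (conc J A v e → conc I A w d)

  WPhase : (Conf → Set) → Conf → Set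
  WPhase P (conf w d v e) =
    ((w' : W I) → ∃[ v' ] P (conf w' d v' e)) ×
    ((v' : W J) → ∃[ w' ] P (conf w' d v' e))

  ΔPhase : (Conf → Set) → Conf → Set
  ΔPhase P (conf w d v e) =
    ((r : NR) (d' : Δ I) → role I r w d d' → ∃[ e' ] (role J r v e e' × P (conf w d' v e'))) ×
    ((r : NR) (e' : Δ J) → role J r v e e' → ∃[ d' ] (role I r w d d' × P (conf w d' v e')))

  -- one round of the ordinary game: S makes a W-move or a Δ-move
  Step : (Conf → Set) → Conf → Set
  Step P c = WPhase P c × ΔPhase P c

  BisN : ℕ → Conf → Set
  BisN zero    c = Good c
  BisN (suc n) c = Good c × Step (BisN n) c

  -- D has a winning strategy in the unbounded game from c:
  -- c lies in some relation Z of safe configurations closed under the game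
  Bis : Conf → Set₁
  Bis c = Σ (Conf → Set) λ Z → Z c × ((c' : Conf) → Z c' → Good c' × Step Z c')

  -- one round of the alternating game, continuing in P:
  -- S either skips phase (i) or makes a W-move (D answers; must stay Good),
  -- then exactly one Δ-move each.
  AltRound : (Conf → Set) → Conf → Set
  AltRound P c = ΔPhase P c × WPhase (λ c' → Good c' × ΔPhase P c') c

  -- n-round alternating game (n rounds, then possibly one extra phase (i))
  AltN : ℕ → Conf → Set
  AltN zero    c = Good c × WPhase Good c
  AltN (suc n) c = Good c × AltRound (AltN n) c

  Alt : Conf → Set₁
  Alt c = Σ (Conf → Set) λ Z → Z c × ((c' : Conf) → Z c' → Good c' × AltRound Z c')

_,_,_≈[_]_,_,_ : ∀ {NC NR} (I : S5Interp NC NR) → W I → Δ I → ℕ →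
                 (J : S5Interp NC NR) → W J → Δ J → Set
I , w , d ≈[ n ] J , v , e = Game.BisN I J n (Game.conf w d v e)

_,_,_≈_,_,_ : ∀ {NC NR} (I : S5Interp NC NR) → W I → Δ I →
              (J : S5Interp NC NR) → W J → Δ J → Set₁
I , w , d ≈ J , v , e = Game.Bis I J (Game.conf w d v e)

_,_,_≈alt[_]_,_,_ : ∀ {NC NR} (I : S5Interp NC NR) → W I → Δ I → ℕ →
                    (J : S5Interp NC NR) → W J → Δ J → Set
I , w , d ≈alt[ n ] J , v , e = Game.AltN I J n (Game.conf w d v e)

_,_,_≈alt_,_,_ : ∀ {NC NR} (I : S5Interp NC NR) → W I → Δ I →
                 (J : S5Interp NC NR) → W J → Δ J → Set₁
I , w , d ≈alt J , v , e = Game.Alt I J (Game.conf w d v e)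

{-# OPTIONS --safe #-}
module Submission where

-- In S5 every world is accessible from every world, so which answers D has to a W-move depends only on
-- the current individuals, not on the current worlds.  Hence consecutive W-moves can be answered like a
-- single one: an ordinary strategy for 2n+1 rounds already plays the W-move and the Δ-move of each
-- alternating round, and conversely an alternating strategy answers a run of W-moves by repeating its
-- single W-answer.  For the unbounded games, an ordinary invariant Z is already an alternating one, and
-- an alternating invariant Z yields the ordinary invariant of configurations from which D survives one
-- alternating round into Z.

open import Defs
open import Data.Nat using (ℕ; zero; suc; _+_)
open import Data.Nat.Properties using (+-suc)
open import Data.Product using (_×_; _,_; proj₁)
open import Level using (0ℓ)
open import Relation.Binary.PropositionalEquality using (subst)
open import Relation.Unary using (Pred; _⊆′_)

module GameProperties {NC NR : Set} (I J : S5Interp NC NR) where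
  open Game I J

  GoodΔ : Pred Conf 0ℓ → Pred Conf 0ℓ
  GoodΔ P c = Good c × ΔPhase P c

  WPhase-map : {P Q : Pred Conf 0ℓ} → P ⊆′ Q → WPhase P ⊆′ WPhase Q
  WPhase-map P⊆Q (conf _ _ _ _) (answerI , answerJ) =
    (λ w' → let (v' , p) = answerI w' in v' , P⊆Q _ p) ,
    (λ v' → let (w' , p) = answerJ v' in w' , P⊆Q _ p)

  ΔPhase-map : {P Q : Pred Conf 0ℓ} → P ⊆′ Q → ΔPhase P ⊆′ ΔPhase Q
  ΔPhase-map P⊆Q (conf _ _ _ _) (answerI , answerJ) =
    (λ r d' edge → let (e' , edge' , p) = answerI r d' edge in e' , edge' , P⊆Q _ p) ,
    (λ r e' edge → let (d' , edge' , p) = answerJ r e' edge in d' , edge' , P⊆Q _ p)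

  Step-map : {P Q : Pred Conf 0ℓ} → P ⊆′ Q → Step P ⊆′ Step Q
  Step-map P⊆Q c (wMoves , δMoves) = WPhase-map P⊆Q c wMoves , ΔPhase-map P⊆Q c δMoves

  GoodΔ-map : {P Q : Pred Conf 0ℓ} → P ⊆′ Q → GoodΔ P ⊆′ GoodΔ Q
  GoodΔ-map P⊆Q c (good , δMoves) = good , ΔPhase-map P⊆Q c δMoves

  AltRound-map : {P Q : Pred Conf 0ℓ} → P ⊆′ Q → AltRound P ⊆′ AltRound Q
  AltRound-map P⊆Q c (δMoves , wMoves) =
    ΔPhase-map P⊆Q c δMoves , WPhase-map (GoodΔ-map P⊆Q) c wMoves

  WPhase-reroot : (P : Pred Conf 0ℓ) (c : Conf) (w' : W I) (v' : W J) →
                  WPhase P c → WPhase P (conf w' (dI c) v' (eJ c))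
  WPhase-reroot P c w' v' wMoves = wMoves

  BisN-suc⇒BisN : ∀ k → BisN (suc k) ⊆′ BisN k
  BisN-suc⇒BisN zero    c (good , _)    = good
  BisN-suc⇒BisN (suc k) c (good , step) = good , Step-map (BisN-suc⇒BisN k) c step

  BisN-suc⇒GoodΔ : ∀ k → BisN (suc k) ⊆′ GoodΔ (BisN k)
  BisN-suc⇒GoodΔ k c (good , _ , δMoves) = good , δMoves

  BisN-2+⇒AltRound : ∀ k → BisN (suc (suc k)) ⊆′ (λ c → Good c × AltRound (BisN k) c)
  BisN-2+⇒AltRound k c (good , wMoves , δMoves) =
    good , ΔPhase-map (BisN-suc⇒BisN k) c δMoves , WPhase-map (BisN-suc⇒GoodΔ k) c wMoves

  BisN⇒AltN : ∀ n → BisN (suc (n + n)) ⊆′ AltN n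
  BisN⇒AltN zero    c (good , wMoves , _) = good , wMoves
  BisN⇒AltN (suc n) c bis =
    let (good , round) = BisN-2+⇒AltRound (suc (n + n)) c
                           (subst (λ k → BisN (suc (suc k)) c) (+-suc n n) bis)
    in good , AltRound-map (BisN⇒AltN n) c round

  WPhase-GoodΔ⇒WPhase-BisN : {P : Pred Conf 0ℓ} → ∀ m → P ⊆′ BisN m →
                             WPhase (GoodΔ P) ⊆′ WPhase (BisN m)
  WPhase-GoodΔ⇒WPhase-BisN zero    _      = WPhase-map (λ _ → proj₁)
  WPhase-GoodΔ⇒WPhase-BisN (suc m) P⊆BisN c@(conf _ _ _ _) wMoves@(answerI , answerJ) =
    (λ w' → let (v' , good , δMoves) = answerI w' in
            v' , good , WPhase-reroot (BisN m) c w' v' later , ΔPhase-map P⊆BisN′ _ δMoves) ,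
    (λ v' → let (w' , good , δMoves) = answerJ v' in
            w' , good , WPhase-reroot (BisN m) c w' v' later , ΔPhase-map P⊆BisN′ _ δMoves)
    where
    P⊆BisN′ : _ ⊆′ BisN m
    P⊆BisN′ c p = BisN-suc⇒BisN m c (P⊆BisN c p)

    later : WPhase (BisN m) c
    later = WPhase-GoodΔ⇒WPhase-BisN m P⊆BisN′ c wMoves

  AltN⇒BisN : ∀ n → AltN n ⊆′ BisN n
  AltN⇒BisN zero    c (good , _) = good
  AltN⇒BisN (suc n) c (good , δMoves , wMoves) =
    good , WPhase-GoodΔ⇒WPhase-BisN n (AltN⇒BisN n) c wMoves , ΔPhase-map (AltN⇒BisN n) c δMoves

  Bis⇒Alt : Bis ⊆′ Alt
  Bis⇒Alt _ (Z , z , closed) = Z , z , closedAlt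
    where
    closed⇒GoodΔ : Z ⊆′ GoodΔ Z
    closed⇒GoodΔ c z′ = let (good , _ , δMoves) = closed c z′ in good , δMoves

    closedAlt : (c : Conf) → Z c → Good c × AltRound Z c
    closedAlt c z′ = let (good , wMoves , δMoves) = closed c z′ in
                     good , δMoves , WPhase-map closed⇒GoodΔ c wMoves

  Alt⇒Bis : Alt ⊆′ Bis
  Alt⇒Bis _ (Z , z , closed) = Z′ , closed _ z , closedBis
    where
    Z′ : Pred Conf 0ℓ
    Z′ c = Good c × AltRound Z c

    closedBis : (c : Conf) → Z′ c → Good c × Step Z′ c
    closedBis c@(conf _ _ _ _) (good , δMoves , wMoves@(answerI , answerJ)) =
      good ,
      ((λ w' → let (v' , good' , δMoves') = answerI w' in
               v' , good' , δMoves' , WPhase-reroot (GoodΔ Z) c w' v' wMoves) ,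
       (λ v' → let (w' , good' , δMoves') = answerJ v' in
               w' , good' , δMoves' , WPhase-reroot (GoodΔ Z) c w' v' wMoves)) ,
      ΔPhase-map closed _ δMoves

lemma11 : {NC NR : Set} (I J : S5Interp NC NR)
    (w : W I) (d : Δ I) (v : W J) (e : Δ J) (n : ℕ) →
    ((I , w , d ≈[ suc (n + n) ] J , v , e) → (I , w , d ≈alt[ n ] J , v , e))
    × ((I , w , d ≈alt[ n ] J , v , e) → (I , w , d ≈[ n ] J , v , e))
    × ((I , w , d ≈ J , v , e) → (I , w , d ≈alt J , v , e))
    × ((I , w , d ≈alt J , v , e) → (I , w , d ≈ J , v , e))
lemma11 I J w d v e n = BisN⇒AltN n _ , AltN⇒BisN n _ , Bis⇒Alt _ , Alt⇒Bis _
  where open GameProperties I J
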